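{- Let $\mathsf{SNEL}'=\mathsf{SNEL}\setminus\{\mathsf{e}\downarrow,\mathsf{e}\uparrow\}$. For every derivation in $\mathsf{SNEL}'$ from $P$ to $Q$ there is a derivation of the shape $P\xrightarrow{\{\mathsf{g}\uparrow,\mathsf{b}\uparrow,\mathsf{w}\uparrow\}}P'\xrightarrow{\mathsf{SNEL}'\setminus\{\mathsf{g}\uparrow,\mathsf{b}\uparrow,\mathsf{w}\uparrow\}}Q$ for some structure $P'$.
   Context: Atoms: countably many atoms $a,b,\dots$, each atom $a$ having a dual atom $\bar a$ with $\bar{\bar a}=a$. Structures are generated by $S::= a\mid \circ \mid [S,\dots,S]\mid (S,\dots,S)\mid \langle S;\dots;S\rangle \mid ?S\mid !S\mid \bar S$ (par, tensor, seq with at least one argument; unit $\circ$ not an atom), identified modulo the least congruence $=$ making par, tensor, seq associative, par and tensor commutative, $\circ$ a unit for all three, $[R]=(R)=\langle R\rangle=R$, with $\bar\circ=\circ$, $\overline{[R_1,\dots,R_h]}=(\bar R_1,\dots,\bar R_h)$, $\overline{(R_1,\dots,R_h)}=[\bar R_1,\dots,\bar R_h]$, $\overline{\langle R_1;\dots;R_h\rangle}=\langle\bar R_1;\dots;\bar R_h\rangle$, $\overline{?R}=!\bar R$, $\overline{!R}=?\bar R$, $\bar{\bar R}=R$. A context $S\{\;\}$ is a structure with one hole not under negation; $S[R,T]$ abbreviates $S\{[R,T]\}$ etc. A derivation in a rule set is a finite vertical chain of rule instances (each conclusion equal modulo $=$ to the next premise), possibly a single structure; top = premise, bottom = conclusion.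 System $\mathsf{SNEL}$ (premise $\Rightarrow$ conclusion): $\mathsf{ai}\downarrow$: $S\{\circ\}\Rightarrow S[a,\bar a]$; $\mathsf{ai}\uparrow$: $S(a,\bar a)\Rightarrow S\{\circ\}$; $\mathsf{s}$: $S([R,U],T)\Rightarrow S[(R,T),U]$; $\mathsf{q}\downarrow$: $S\langle[R,U];[T,V]\rangle\Rightarrow S[\langle R;T\rangle,\langle U;V\rangle]$; $\mathsf{q}\uparrow$: $S(\langle R;U\rangle,\langle T;V\rangle)\Rightarrow S\langle(R,T);(U,V)\rangle$; $\mathsf{p}\downarrow$: $S\{![R,T]\}\Rightarrow S[!R,?T]$; $\mathsf{p}\uparrow$: $S(?R,!T)\Rightarrow S\{?(R,T)\}$; $\mathsf{e}\downarrow$: $S\{\circ\}\Rightarrow S\{!\circ\}$; $\mathsf{e}\uparrow$: $S\{?\circ\}\Rightarrow S\{\circ\}$; $\mathsf{w}\downarrow$: $S\{\circ\}\Rightarrow S\{?R\}$; $\mathsf{w}\uparrow$: $S\{!R\}\Rightarrow S\{\circ\}$; $\mathsf{b}\downarrow$: $S[?R,R]\Rightarrow S\{?R\}$; $\mathsf{b}\uparrow$: $S\{!R\}\Rightarrow S(!R,R)$; $\mathsf{g}\downarrow$: $S\{??R\}\Rightarrow S\{?R\}$; $\mathsf{g}\uparrow$: $S\{!R\}\Rightarrow S\{!!R\}$. Notation $X_0\xrightarrow{\mathcal X_1}X_1\xrightarrow{\mathcal X_2}X_2$ denotes a derivation from $X_0$ to $X_2$ obtained by stacking a derivation from $X_0$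 to $X_1$ in $\mathcal X_1$ over one from $X_1$ to $X_2$ in $\mathcal X_2$ (each possibly with no rule instance). -}

module Defs where

open import Data.Nat using (ℕ)
open import Data.Bool using (Bool; not)
open import Data.Product using (Σ; _×_; _,_; ∃)
open import Relation.Binary.PropositionalEquality using (_≡_)

Atom : Set
Atom = ℕ × Bool

dual : Atom → Atom
dual (n , b) = n , not b

-- The n-ary par/tensor/seq (h ≥ 1) are
-- represented by binary constructors; the singleton case [R]=(R)=⟨R⟩=R
-- and arbitrary arities are recovered via associativity.

infixr 5 _⅋_ _⊗_ _▷_

data Str : Set where
  atom : Atom → Str
  ∘    : Str
  _⅋_  : Str → Str → Str
  _⊗_  : Str → Str → Str
  _▷_  : Str → Str → Str
  ¿_   : Str → Str
  !_   : Str → Str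
  neg  : Str → Str

infix 4 _≈_

data _≈_ : Str → Str → Set where
  ≈-refl  : ∀ {R} → R ≈ R
  ≈-sym   : ∀ {R T} → R ≈ T → T ≈ R
  ≈-trans : ∀ {R T U} → R ≈ T → T ≈ U → R ≈ U
  ⅋-cong  : ∀ {R R' T T'} → R ≈ R' → T ≈ T' → (R ⅋ T) ≈ (R' ⅋ T')
  ⊗-cong  : ∀ {R R' T T'} → R ≈ R' → T ≈ T' → (R ⊗ T) ≈ (R' ⊗ T')
  ▷-cong  : ∀ {R R' T T'} → R ≈ R' → T ≈ T' → (R ▷ T) ≈ (R' ▷ T')
  ¿-cong  : ∀ {R R'} → R ≈ R' → (¿ R) ≈ (¿ R')
  !-cong  : ∀ {R R'} → R ≈ R' → (! R) ≈ (! R')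
  neg-cong : ∀ {R R'} → R ≈ R' → neg R ≈ neg R'
  ⅋-assoc : ∀ {R T U} → ((R ⅋ T) ⅋ U) ≈ (R ⅋ (T ⅋ U))
  ⊗-assoc : ∀ {R T U} → ((R ⊗ T) ⊗ U) ≈ (R ⊗ (T ⊗ U))
  ▷-assoc : ∀ {R T U} → ((R ▷ T) ▷ U) ≈ (R ▷ (T ▷ U))
  ⅋-comm  : ∀ {R T} → (R ⅋ T) ≈ (T ⅋ R)
  ⊗-comm  : ∀ {R T} → (R ⊗ T) ≈ (T ⊗ R)
  ⅋-unitˡ : ∀ {R} → (∘ ⅋ R) ≈ R
  ⊗-unitˡ : ∀ {R} → (∘ ⊗ R) ≈ R
  ▷-unitˡ : ∀ {R} → (∘ ▷ R) ≈ R
  ▷-unitʳ : ∀ {R} → (R ▷ ∘) ≈ R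
  neg-atom : ∀ {a} → neg (atom a) ≈ atom (dual a)
  neg-∘   : neg ∘ ≈ ∘
  neg-⅋   : ∀ {R T} → neg (R ⅋ T) ≈ (neg R ⊗ neg T)
  neg-⊗   : ∀ {R T} → neg (R ⊗ T) ≈ (neg R ⅋ neg T)
  neg-▷   : ∀ {R T} → neg (R ▷ T) ≈ (neg R ▷ neg T)
  neg-¿   : ∀ {R} → neg (¿ R) ≈ (! neg R)
  neg-!   : ∀ {R} → neg (! R) ≈ (¿ neg R)
  neg-neg : ∀ {R} → neg (neg R) ≈ R

-- Contexts: one hole, not under negation.

data Ctx : Set where
  hole : Ctx
  ⅋ˡ  : Ctx → Str → Ctx
  ⅋ʳ  : Str → Ctx → Ctx
  ⊗ˡ  : Ctx → Str → Ctx
  ⊗ʳ  : Str → Ctx → Ctx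
  ▷ˡ  : Ctx → Str → Ctx
  ▷ʳ  : Str → Ctx → Ctx
  ¿c  : Ctx → Ctx
  !c  : Ctx → Ctx

plug : Ctx → Str → Str
plug hole      R = R
plug (⅋ˡ S T) R = plug S R ⅋ T
plug (⅋ʳ T S) R = T ⅋ plug S R
plug (⊗ˡ S T) R = plug S R ⊗ T
plug (⊗ʳ T S) R = T ⊗ plug S R
plug (▷ˡ S T) R = plug S R ▷ T
plug (▷ʳ T S) R = T ▷ plug S R
plug (¿c S)   R = ¿ plug S R
plug (!c S)   R = ! plug S R

data Rule : Set where
  ai↓ ai↑ s q↓ q↑ p↓ p↑ e↓ e↑ w↓ w↑ b↓ b↑ g↓ g↑ : Rule

data Inst : Rule → Str → Str → Set where
  ai↓ : ∀ a → Inst ai↓ ∘ (atom a ⅋ atom (dual a))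
  ai↑ : ∀ a → Inst ai↑ (atom a ⊗ atom (dual a)) ∘
  s   : ∀ R T U → Inst s ((R ⅋ U) ⊗ T) ((R ⊗ T) ⅋ U)
  q↓  : ∀ R T U V → Inst q↓ ((R ⅋ U) ▷ (T ⅋ V)) ((R ▷ T) ⅋ (U ▷ V))
  q↑  : ∀ R T U V → Inst q↑ ((R ▷ U) ⊗ (T ▷ V)) ((R ⊗ T) ▷ (U ⊗ V))
  p↓  : ∀ R T → Inst p↓ (! (R ⅋ T)) (! R ⅋ ¿ T)
  p↑  : ∀ R T → Inst p↑ (¿ R ⊗ ! T) (¿ (R ⊗ T))
  e↓  : Inst e↓ ∘ (! ∘)
  e↑  : Inst e↑ (¿ ∘) ∘
  w↓  : ∀ R → Inst w↓ ∘ (¿ R)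
  w↑  : ∀ R → Inst w↑ (! R) ∘
  b↓  : ∀ R → Inst b↓ (¿ R ⅋ R) (¿ R)
  b↑  : ∀ R → Inst b↑ (! R) (! R ⊗ R)
  g↓  : ∀ R → Inst g↓ (¿ ¿ R) (¿ R)
  g↑  : ∀ R → Inst g↑ (! R) (! ! R)

record Step (r : Rule) (P Q : Str) : Set where
  constructor step
  field
    ctx  : Ctx
    prem : Str
    conc : Str
    inst : Inst r prem conc
    P≈   : P ≈ plug ctx prem
    Q≈   : Q ≈ plug ctx conc

data Deriv (X : Rule → Set) : Str → Str → Set where
  done : ∀ {P Q} → P ≈ Q → Deriv X P Q
  _∷_  : ∀ {r P M Q} → X r × Step r P M → Deriv X M Q → Deriv X P Q

data SNEL′ : Rule → Set where
  ai↓ : SNEL′ ai↓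
  ai↑ : SNEL′ ai↑
  s   : SNEL′ s
  q↓  : SNEL′ q↓
  q↑  : SNEL′ q↑
  p↓  : SNEL′ p↓
  p↑  : SNEL′ p↑
  w↓  : SNEL′ w↓
  w↑  : SNEL′ w↑
  b↓  : SNEL′ b↓
  b↑  : SNEL′ b↑
  g↓  : SNEL′ g↓
  g↑  : SNEL′ g↑

data UpGBW : Rule → Set where
  g↑ : UpGBW g↑
  b↑ : UpGBW b↑
  w↑ : UpGBW w↑

data SNEL′∖GBW : Rule → Set where
  ai↓ : SNEL′∖GBW ai↓
  ai↑ : SNEL′∖GBW ai↑
  s   : SNEL′∖GBW s
  q↓  : SNEL′∖GBW q↓
  q↑  : SNEL′∖GBW q↑
  p↓  : SNEL′∖GBW p↓
  p↑  : SNEL′∖GBW p↑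
  w↓  : SNEL′∖GBW w↓
  b↓  : SNEL′∖GBW b↓
  g↓  : SNEL′∖GBW g↓

-- The rules g↑, b↑ and w↑ unfold a !R in positive position into any ⊗-tree of !'s, units and
-- copies of R (a shape). Call an expansion of a structure a simultaneous unfolding of some of
-- its positive !-subformulas (dually, of ¿-subformulas under an odd number of negations).
-- Expansions are realised by up-rules, respect =, and can be moved above every other rule of
-- SNEL′: if A ⇒ B by such a rule and B expands to C, then A expands to some Z from which C is
-- derivable without g↑, b↑, w↑. The one substantial case is p↓, which is replaced by a
-- derivation from a shape of [R,T] to [shape of R, ?T] built from s, p↓, w↓, b↓ and g↓.
-- Sweeping the derivation from top to bottom, every up-step is thus pushed above all the
-- down-steps collected so far.
module Submission where

open import Defs
open import Data.Product using (Σ; _×_; _,_; ∃-syntax)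
open import Data.Sum using (_⊎_; inj₁; inj₂)
open import Relation.Binary.PropositionalEquality using (_≡_; refl)

private
  variable
    X : Rule → Set
    r : Rule
    A A′ B B′ C M M′ N N′ R R′ T T′ : Str

Up : Rule → Set
Up = UpGBW

Down : Rule → Set
Down = SNEL′∖GBW

_∘ᶜ_ : Ctx → Ctx → Ctx
hole    ∘ᶜ S = S
⅋ˡ C T  ∘ᶜ S = ⅋ˡ (C ∘ᶜ S) T
⅋ʳ T C  ∘ᶜ S = ⅋ʳ T (C ∘ᶜ S)
⊗ˡ C T  ∘ᶜ S = ⊗ˡ (C ∘ᶜ S) T
⊗ʳ T C  ∘ᶜ S = ⊗ʳ T (C ∘ᶜ S)
▷ˡ C T  ∘ᶜ S = ▷ˡ (C ∘ᶜ S) T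
▷ʳ T C  ∘ᶜ S = ▷ʳ T (C ∘ᶜ S)
¿c C    ∘ᶜ S = ¿c (C ∘ᶜ S)
!c C    ∘ᶜ S = !c (C ∘ᶜ S)

plug-∘ᶜ : ∀ C S R → plug C (plug S R) ≈ plug (C ∘ᶜ S) R
plug-∘ᶜ hole     S R = ≈-refl
plug-∘ᶜ (⅋ˡ C T) S R = ⅋-cong (plug-∘ᶜ C S R) ≈-refl
plug-∘ᶜ (⅋ʳ T C) S R = ⅋-cong ≈-refl (plug-∘ᶜ C S R)
plug-∘ᶜ (⊗ˡ C T) S R = ⊗-cong (plug-∘ᶜ C S R) ≈-refl
plug-∘ᶜ (⊗ʳ T C) S R = ⊗-cong ≈-refl (plug-∘ᶜ C S R)
plug-∘ᶜ (▷ˡ C T) S R = ▷-cong (plug-∘ᶜ C S R) ≈-refl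
plug-∘ᶜ (▷ʳ T C) S R = ▷-cong ≈-refl (plug-∘ᶜ C S R)
plug-∘ᶜ (¿c C)   S R = ¿-cong (plug-∘ᶜ C S R)
plug-∘ᶜ (!c C)   S R = !-cong (plug-∘ᶜ C S R)

plug-cong : ∀ C → A ≈ B → plug C A ≈ plug C B
plug-cong hole     e = e
plug-cong (⅋ˡ C T) e = ⅋-cong (plug-cong C e) ≈-refl
plug-cong (⅋ʳ T C) e = ⅋-cong ≈-refl (plug-cong C e)
plug-cong (⊗ˡ C T) e = ⊗-cong (plug-cong C e) ≈-refl
plug-cong (⊗ʳ T C) e = ⊗-cong ≈-refl (plug-cong C e)
plug-cong (▷ˡ C T) e = ▷-cong (plug-cong C e) ≈-refl
plug-cong (▷ʳ T C) e = ▷-cong ≈-refl (plug-cong C e)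
plug-cong (¿c C)   e = ¿-cong (plug-cong C e)
plug-cong (!c C)   e = !-cong (plug-cong C e)

≈-premise : A ≈ B → Deriv X B C → Deriv X A C
≈-premise eq (done e) = done (≈-trans eq e)
≈-premise eq ((x , step S pr cn i P≈ Q≈) ∷ d) = (x , step S pr cn i (≈-trans eq P≈) Q≈) ∷ d

≈-conclusion : Deriv X A B → B ≈ C → Deriv X A C
≈-conclusion (done e) eq = done (≈-trans e eq)
≈-conclusion (st ∷ d) eq = st ∷ ≈-conclusion d eq

resp-≈ : A ≈ A′ → B ≈ B′ → Deriv X A′ B′ → Deriv X A B
resp-≈ eqA eqB d = ≈-premise eqA (≈-conclusion d (≈-sym eqB))

infixr 5 _++_

_++_ : Deriv X A B → Deriv X B C → Deriv X A C
done e   ++ d = ≈-premise e d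
(st ∷ d) ++ d′ = st ∷ (d ++ d′)

rule : ∀ {pr cn} → X r → (S : Ctx) → Inst r pr cn → Deriv X (plug S pr) (plug S cn)
rule x S i = (x , step S _ _ i ≈-refl ≈-refl) ∷ done ≈-refl

inContext : ∀ C → Deriv X A B → Deriv X (plug C A) (plug C B)
inContext C (done e) = done (plug-cong C e)
inContext C ((x , step S pr cn i P≈ Q≈) ∷ d) =
  (x , step (C ∘ᶜ S) pr cn i (≈-trans (plug-cong C P≈) (plug-∘ᶜ C S pr))
                             (≈-trans (plug-cong C Q≈) (plug-∘ᶜ C S cn)))
  ∷ inContext C d

⅋-deriv : Deriv X A A′ → Deriv X B B′ → Deriv X (A ⅋ B) (A′ ⅋ B′)
⅋-deriv d e = inContext (⅋ˡ hole _) d ++ inContext (⅋ʳ _ hole) e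

⊗-deriv : Deriv X A A′ → Deriv X B B′ → Deriv X (A ⊗ B) (A′ ⊗ B′)
⊗-deriv d e = inContext (⊗ˡ hole _) d ++ inContext (⊗ʳ _ hole) e

▷-deriv : Deriv X A A′ → Deriv X B B′ → Deriv X (A ▷ B) (A′ ▷ B′)
▷-deriv d e = inContext (▷ˡ hole _) d ++ inContext (▷ʳ _ hole) e

infixr 6 _⊗ˢ_

data Shape : Set where
  leaf unit : Shape
  _⊗ˢ_      : Shape → Shape → Shape
  !ˢ_       : Shape → Shape

shape! : Shape → Str → Str
shape! leaf     R = R
shape! unit     R = ∘
shape! (t ⊗ˢ u) R = shape! t R ⊗ shape! u R
shape! (!ˢ t)   R = ! shape! t R

shape¿ : Shape → Str → Str
shape¿ leaf     R = R
shape¿ unit     R = ∘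
shape¿ (t ⊗ˢ u) R = shape¿ t R ⅋ shape¿ u R
shape¿ (!ˢ t)   R = ¿ shape¿ t R

shape!-cong : ∀ t → A ≈ B → shape! t A ≈ shape! t B
shape!-cong leaf     e = e
shape!-cong unit     e = ≈-refl
shape!-cong (t ⊗ˢ u) e = ⊗-cong (shape!-cong t e) (shape!-cong u e)
shape!-cong (!ˢ t)   e = !-cong (shape!-cong t e)

shape¿-cong : ∀ t → A ≈ B → shape¿ t A ≈ shape¿ t B
shape¿-cong leaf     e = e
shape¿-cong unit     e = ≈-refl
shape¿-cong (t ⊗ˢ u) e = ⅋-cong (shape¿-cong t e) (shape¿-cong u e)
shape¿-cong (!ˢ t)   e = ¿-cong (shape¿-cong t e)

neg-shape¿ : ∀ t R → neg (shape¿ t R) ≈ shape! t (neg R)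
neg-shape¿ leaf     R = ≈-refl
neg-shape¿ unit     R = neg-∘
neg-shape¿ (t ⊗ˢ u) R = ≈-trans neg-⅋ (⊗-cong (neg-shape¿ t R) (neg-shape¿ u R))
neg-shape¿ (!ˢ t)   R = ≈-trans neg-¿ (!-cong (neg-shape¿ t R))

neg-shape! : ∀ t R → neg (shape! t R) ≈ shape¿ t (neg R)
neg-shape! leaf     R = ≈-refl
neg-shape! unit     R = neg-∘
neg-shape! (t ⊗ˢ u) R = ≈-trans neg-⊗ (⅋-cong (neg-shape! t R) (neg-shape! u R))
neg-shape! (!ˢ t)   R = ≈-trans neg-! (¿-cong (neg-shape! t R))

shape!-map : ∀ t → Deriv X A B → Deriv X (shape! t A) (shape! t B)
shape!-map leaf     d = d
shape!-map unit     d = done ≈-refl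
shape!-map (t ⊗ˢ u) d = ⊗-deriv (shape!-map t d) (shape!-map u d)
shape!-map (!ˢ t)   d = inContext (!c hole) (shape!-map t d)

data Polarity : Set where
  ⁺ ⁻ : Polarity

flip : Polarity → Polarity
flip ⁺ = ⁻
flip ⁻ = ⁺

private
  variable
    p : Polarity

-- Expands ⁻ R R′ means that neg R expands to neg R′. A plain ! in positive position is
-- the shape !ˢ leaf, hence !⁺ and ¿⁻ also cover the congruence cases.
data Expands : Polarity → Str → Str → Set where
  atom : ∀ {a} → Expands p (atom a) (atom a)
  ∘    : Expands p ∘ ∘
  _⅋_  : Expands p R R′ → Expands p T T′ → Expands p (R ⅋ T) (R′ ⅋ T′)
  _⊗_  : Expands p R R′ → Expands p T T′ → Expands p (R ⊗ T) (R′ ⊗ T′)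
  _▷_  : Expands p R R′ → Expands p T T′ → Expands p (R ▷ T) (R′ ▷ T′)
  ¿⁺   : Expands ⁺ R R′ → Expands ⁺ (¿ R) (¿ R′)
  !⁻   : Expands ⁻ R R′ → Expands ⁻ (! R) (! R′)
  !⁺   : ∀ t → Expands ⁺ R R′ → Expands ⁺ (! R) (shape! t R′)
  ¿⁻   : ∀ t → Expands ⁻ R R′ → Expands ⁻ (¿ R) (shape¿ t R′)
  neg  : Expands (flip p) R R′ → Expands p (neg R) (neg R′)

expands-refl : ∀ p R → Expands p R R
expands-refl p (atom a) = atom
expands-refl p ∘ = ∘
expands-refl p (R ⅋ T) = expands-refl p R ⅋ expands-refl p T
expands-refl p (R ⊗ T) = expands-refl p R ⊗ expands-refl p T
expands-refl p (R ▷ T) = expands-refl p R ▷ expands-refl p T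
expands-refl ⁺ (¿ R) = ¿⁺ (expands-refl ⁺ R)
expands-refl ⁻ (¿ R) = ¿⁻ (!ˢ leaf) (expands-refl ⁻ R)
expands-refl ⁺ (! R) = !⁺ (!ˢ leaf) (expands-refl ⁺ R)
expands-refl ⁻ (! R) = !⁻ (expands-refl ⁻ R)
expands-refl p (neg R) = neg (expands-refl (flip p) R)

expands-in-context : ∀ S → Expands ⁺ A B → Expands ⁺ (plug S A) (plug S B)
expands-in-context hole     e = e
expands-in-context (⅋ˡ S T) e = expands-in-context S e ⅋ expands-refl ⁺ T
expands-in-context (⅋ʳ T S) e = expands-refl ⁺ T ⅋ expands-in-context S e
expands-in-context (⊗ˡ S T) e = expands-in-context S e ⊗ expands-refl ⁺ T
expands-in-context (⊗ʳ T S) e = expands-refl ⁺ T ⊗ expands-in-context S e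
expands-in-context (▷ˡ S T) e = expands-in-context S e ▷ expands-refl ⁺ T
expands-in-context (▷ʳ T S) e = expands-refl ⁺ T ▷ expands-in-context S e
expands-in-context (¿c S)   e = ¿⁺ (expands-in-context S e)
expands-in-context (!c S)   e = !⁺ (!ˢ leaf) (expands-in-context S e)

flip-flip : Expands (flip (flip p)) R R′ → Expands p R R′
flip-flip {⁺} e = e
flip-flip {⁻} e = e

unflip-flip : Expands p R R′ → Expands (flip (flip p)) R R′
unflip-flip {⁺} e = e
unflip-flip {⁻} e = e

expands-resp-≈ : M ≈ N → Expands p M M′ → ∃[ N′ ] Expands p N N′ × M′ ≈ N′
expands-resp-≈˘ : M ≈ N → Expands p N N′ → ∃[ M′ ] Expands p M M′ × M′ ≈ N′

expands-resp-≈ ≈-refl e = _ , e , ≈-refl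
expands-resp-≈ (≈-sym q) e =
  let _ , e′ , eq = expands-resp-≈˘ q e in _ , e′ , ≈-sym eq
expands-resp-≈ (≈-trans q r) e =
  let _ , e₁ , eq₁ = expands-resp-≈ q e
      _ , e₂ , eq₂ = expands-resp-≈ r e₁
  in _ , e₂ , ≈-trans eq₁ eq₂
expands-resp-≈ (⅋-cong q r) (a ⅋ b) =
  let _ , a′ , eq₁ = expands-resp-≈ q a ; _ , b′ , eq₂ = expands-resp-≈ r b
  in _ , a′ ⅋ b′ , ⅋-cong eq₁ eq₂
expands-resp-≈ (⊗-cong q r) (a ⊗ b) =
  let _ , a′ , eq₁ = expands-resp-≈ q a ; _ , b′ , eq₂ = expands-resp-≈ r b
  in _ , a′ ⊗ b′ , ⊗-cong eq₁ eq₂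
expands-resp-≈ (▷-cong q r) (a ▷ b) =
  let _ , a′ , eq₁ = expands-resp-≈ q a ; _ , b′ , eq₂ = expands-resp-≈ r b
  in _ , a′ ▷ b′ , ▷-cong eq₁ eq₂
expands-resp-≈ (¿-cong q) (¿⁺ a) =
  let _ , a′ , eq = expands-resp-≈ q a in _ , ¿⁺ a′ , ¿-cong eq
expands-resp-≈ (¿-cong q) (¿⁻ t a) =
  let _ , a′ , eq = expands-resp-≈ q a in _ , ¿⁻ t a′ , shape¿-cong t eq
expands-resp-≈ (!-cong q) (!⁻ a) =
  let _ , a′ , eq = expands-resp-≈ q a in _ , !⁻ a′ , !-cong eq
expands-resp-≈ (!-cong q) (!⁺ t a) =
  let _ , a′ , eq = expands-resp-≈ q a in _ , !⁺ t a′ , shape!-cong t eq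
expands-resp-≈ (neg-cong q) (neg a) =
  let _ , a′ , eq = expands-resp-≈ q a in _ , neg a′ , neg-cong eq
expands-resp-≈ ⅋-assoc ((a ⅋ b) ⅋ c) = _ , a ⅋ (b ⅋ c) , ⅋-assoc
expands-resp-≈ ⊗-assoc ((a ⊗ b) ⊗ c) = _ , a ⊗ (b ⊗ c) , ⊗-assoc
expands-resp-≈ ▷-assoc ((a ▷ b) ▷ c) = _ , a ▷ (b ▷ c) , ▷-assoc
expands-resp-≈ ⅋-comm (a ⅋ b) = _ , b ⅋ a , ⅋-comm
expands-resp-≈ ⊗-comm (a ⊗ b) = _ , b ⊗ a , ⊗-comm
expands-resp-≈ ⅋-unitˡ (∘ ⅋ b) = _ , b , ⅋-unitˡ
expands-resp-≈ ⊗-unitˡ (∘ ⊗ b) = _ , b , ⊗-unitˡ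
expands-resp-≈ ▷-unitˡ (∘ ▷ b) = _ , b , ▷-unitˡ
expands-resp-≈ ▷-unitʳ (a ▷ ∘) = _ , a , ▷-unitʳ
expands-resp-≈ neg-atom (neg atom) = _ , atom , neg-atom
expands-resp-≈ neg-∘ (neg ∘) = _ , ∘ , neg-∘
expands-resp-≈ neg-⅋ (neg (a ⅋ b)) = _ , neg a ⊗ neg b , neg-⅋
expands-resp-≈ neg-⊗ (neg (a ⊗ b)) = _ , neg a ⅋ neg b , neg-⊗
expands-resp-≈ neg-▷ (neg (a ▷ b)) = _ , neg a ▷ neg b , neg-▷
expands-resp-≈ {p = ⁻} neg-¿ (neg (¿⁺ a)) = _ , !⁻ (neg a) , neg-¿
expands-resp-≈ {p = ⁺} neg-¿ (neg (¿⁻ t a)) = _ , !⁺ t (neg a) , neg-shape¿ t _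
expands-resp-≈ {p = ⁺} neg-! (neg (!⁻ a)) = _ , ¿⁺ (neg a) , neg-!
expands-resp-≈ {p = ⁻} neg-! (neg (!⁺ t a)) = _ , ¿⁻ t (neg a) , neg-shape! t _
expands-resp-≈ neg-neg (neg (neg a)) = _ , flip-flip a , neg-neg

expands-resp-≈˘ ≈-refl e = _ , e , ≈-refl
expands-resp-≈˘ (≈-sym q) e =
  let _ , e′ , eq = expands-resp-≈ q e in _ , e′ , ≈-sym eq
expands-resp-≈˘ (≈-trans q r) e =
  let _ , e₁ , eq₁ = expands-resp-≈˘ r e
      _ , e₂ , eq₂ = expands-resp-≈˘ q e₁
  in _ , e₂ , ≈-trans eq₂ eq₁
expands-resp-≈˘ (⅋-cong q r) (a ⅋ b) =
  let _ , a′ , eq₁ = expands-resp-≈˘ q a ; _ , b′ , eq₂ = expands-resp-≈˘ r b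
  in _ , a′ ⅋ b′ , ⅋-cong eq₁ eq₂
expands-resp-≈˘ (⊗-cong q r) (a ⊗ b) =
  let _ , a′ , eq₁ = expands-resp-≈˘ q a ; _ , b′ , eq₂ = expands-resp-≈˘ r b
  in _ , a′ ⊗ b′ , ⊗-cong eq₁ eq₂
expands-resp-≈˘ (▷-cong q r) (a ▷ b) =
  let _ , a′ , eq₁ = expands-resp-≈˘ q a ; _ , b′ , eq₂ = expands-resp-≈˘ r b
  in _ , a′ ▷ b′ , ▷-cong eq₁ eq₂
expands-resp-≈˘ (¿-cong q) (¿⁺ a) =
  let _ , a′ , eq = expands-resp-≈˘ q a in _ , ¿⁺ a′ , ¿-cong eq
expands-resp-≈˘ (¿-cong q) (¿⁻ t a) =
  let _ , a′ , eq = expands-resp-≈˘ q a in _ , ¿⁻ t a′ , shape¿-cong t eq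
expands-resp-≈˘ (!-cong q) (!⁻ a) =
  let _ , a′ , eq = expands-resp-≈˘ q a in _ , !⁻ a′ , !-cong eq
expands-resp-≈˘ (!-cong q) (!⁺ t a) =
  let _ , a′ , eq = expands-resp-≈˘ q a in _ , !⁺ t a′ , shape!-cong t eq
expands-resp-≈˘ (neg-cong q) (neg a) =
  let _ , a′ , eq = expands-resp-≈˘ q a in _ , neg a′ , neg-cong eq
expands-resp-≈˘ ⅋-assoc (a ⅋ (b ⅋ c)) = _ , (a ⅋ b) ⅋ c , ⅋-assoc
expands-resp-≈˘ ⊗-assoc (a ⊗ (b ⊗ c)) = _ , (a ⊗ b) ⊗ c , ⊗-assoc
expands-resp-≈˘ ▷-assoc (a ▷ (b ▷ c)) = _ , (a ▷ b) ▷ c , ▷-assoc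
expands-resp-≈˘ ⅋-comm (a ⅋ b) = _ , b ⅋ a , ⅋-comm
expands-resp-≈˘ ⊗-comm (a ⊗ b) = _ , b ⊗ a , ⊗-comm
expands-resp-≈˘ ⅋-unitˡ b = _ , ∘ ⅋ b , ⅋-unitˡ
expands-resp-≈˘ ⊗-unitˡ b = _ , ∘ ⊗ b , ⊗-unitˡ
expands-resp-≈˘ ▷-unitˡ b = _ , ∘ ▷ b , ▷-unitˡ
expands-resp-≈˘ ▷-unitʳ a = _ , a ▷ ∘ , ▷-unitʳ
expands-resp-≈˘ neg-atom atom = _ , neg atom , neg-atom
expands-resp-≈˘ neg-∘ ∘ = _ , neg ∘ , neg-∘
expands-resp-≈˘ neg-⅋ (neg a ⊗ neg b) = _ , neg (a ⅋ b) , neg-⅋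
expands-resp-≈˘ neg-⊗ (neg a ⅋ neg b) = _ , neg (a ⊗ b) , neg-⊗
expands-resp-≈˘ neg-▷ (neg a ▷ neg b) = _ , neg (a ▷ b) , neg-▷
expands-resp-≈˘ {p = ⁻} neg-¿ (!⁻ (neg a)) = _ , neg (¿⁺ a) , neg-¿
expands-resp-≈˘ {p = ⁺} neg-¿ (!⁺ t (neg a)) = _ , neg (¿⁻ t a) , neg-shape¿ t _
expands-resp-≈˘ {p = ⁺} neg-! (¿⁺ (neg a)) = _ , neg (!⁻ a) , neg-!
expands-resp-≈˘ {p = ⁻} neg-! (¿⁻ t (neg a)) = _ , neg (!⁺ t a) , neg-shape! t _
expands-resp-≈˘ neg-neg e = _ , neg (neg (unflip-flip e)) , neg-neg

dereliction↑ : ∀ R → Deriv Up (! R) R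
dereliction↑ R = rule b↑ hole (b↑ R) ++ ≈-conclusion (rule w↑ (⊗ˡ hole R) (w↑ R)) ⊗-unitˡ

unfold! : ∀ t R → Deriv Up (! R) (shape! t R)
unfold! leaf     R = dereliction↑ R
unfold! unit     R = rule w↑ hole (w↑ R)
unfold! (!ˢ t)   R = rule g↑ hole (g↑ R) ++ inContext (!c hole) (unfold! t R)
unfold! (t ⊗ˢ u) R =
  rule g↑ hole (g↑ R) ++ rule b↑ hole (b↑ (! R))
  ++ ⊗-deriv (dereliction↑ (! R) ++ unfold! t R) (unfold! u R)

realize⁺ : Expands ⁺ M M′ → Deriv Up M M′
realize⁻ : Expands ⁻ M M′ → Deriv Up (neg M) (neg M′)

realize⁺ atom = done ≈-refl
realize⁺ ∘ = done ≈-refl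
realize⁺ (a ⅋ b) = ⅋-deriv (realize⁺ a) (realize⁺ b)
realize⁺ (a ⊗ b) = ⊗-deriv (realize⁺ a) (realize⁺ b)
realize⁺ (a ▷ b) = ▷-deriv (realize⁺ a) (realize⁺ b)
realize⁺ (¿⁺ a) = inContext (¿c hole) (realize⁺ a)
realize⁺ (!⁺ t a) = inContext (!c hole) (realize⁺ a) ++ unfold! t _
realize⁺ (neg a) = realize⁻ a

realize⁻ atom = done ≈-refl
realize⁻ ∘ = done ≈-refl
realize⁻ (a ⅋ b) = resp-≈ neg-⅋ neg-⅋ (⊗-deriv (realize⁻ a) (realize⁻ b))
realize⁻ (a ⊗ b) = resp-≈ neg-⊗ neg-⊗ (⅋-deriv (realize⁻ a) (realize⁻ b))
realize⁻ (a ▷ b) = resp-≈ neg-▷ neg-▷ (▷-deriv (realize⁻ a) (realize⁻ b))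
realize⁻ (!⁻ a) = resp-≈ neg-! neg-! (inContext (¿c hole) (realize⁻ a))
realize⁻ (¿⁻ t a) =
  resp-≈ neg-¿ (neg-shape¿ t _) (inContext (!c hole) (realize⁻ a) ++ unfold! t _)
realize⁻ (neg a) = resp-≈ neg-neg neg-neg (realize⁺ a)

dereliction↓ : ∀ T → Deriv Down T (¿ T)
dereliction↓ T =
  ≈-premise (≈-sym ⅋-unitˡ) (rule w↓ (⅋ˡ hole T) (w↓ T)) ++ rule b↓ hole (b↓ T)

contraction↓ : ∀ T → Deriv Down (¿ T ⅋ ¿ T) (¿ T)
contraction↓ T =
  inContext (⅋ˡ hole (¿ T)) (dereliction↓ (¿ T))
  ++ rule b↓ hole (b↓ (¿ T)) ++ rule g↓ hole (g↓ T)

switch₂ : ∀ A B C D → Deriv Down ((A ⅋ C) ⊗ (B ⅋ D)) ((A ⊗ B) ⅋ (C ⅋ D))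
switch₂ A B C D =
  rule s hole (s A (B ⅋ D) C)
  ++ resp-≈ (⅋-cong ⊗-comm ≈-refl) (≈-sym (≈-trans ⅋-assoc (⅋-cong ⊗-comm ⅋-comm)))
       (inContext (⅋ˡ hole C) (rule s hole (s B A D)))

promotion↓ : ∀ t R T → Deriv Down (shape! t (R ⅋ T)) (shape! t R ⅋ ¿ T)
promotion↓ leaf     R T = inContext (⅋ʳ R hole) (dereliction↓ T)
promotion↓ unit     R T = ≈-conclusion (rule w↓ hole (w↓ T)) (≈-sym ⅋-unitˡ)
promotion↓ (!ˢ t)   R T =
  inContext (!c hole) (promotion↓ t R T) ++ rule p↓ hole (p↓ (shape! t R) (¿ T))
  ++ inContext (⅋ʳ _ hole) (rule g↓ hole (g↓ T))
promotion↓ (t ⊗ˢ u) R T =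
  ⊗-deriv (promotion↓ t R T) (promotion↓ u R T)
  ++ switch₂ (shape! t R) (shape! u R) (¿ T) (¿ T)
  ++ inContext (⅋ʳ _ hole) (contraction↓ T)

ExpandThenDown : Str → Str → Set
ExpandThenDown A C = ∃[ Z ] Expands ⁺ A Z × Deriv Down Z C

expand-above-instance : ∀ {pr cn} → Down r → Inst r pr cn → Expands ⁺ cn C → ExpandThenDown pr C
expand-above-instance x (ai↓ a) (atom ⅋ atom) = _ , ∘ , rule x hole (ai↓ a)
expand-above-instance x (ai↑ a) ∘ = _ , expands-refl ⁺ _ , rule x hole (ai↑ a)
expand-above-instance x (s R T U) ((a ⊗ b) ⅋ c) = _ , (a ⅋ c) ⊗ b , rule x hole (s _ _ _)
expand-above-instance x (q↓ R T U V) ((a ▷ b) ⅋ (c ▷ d)) =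
  _ , (a ⅋ c) ▷ (b ⅋ d) , rule x hole (q↓ _ _ _ _)
expand-above-instance x (q↑ R T U V) ((a ⊗ b) ▷ (c ⊗ d)) =
  _ , (a ▷ c) ⊗ (b ▷ d) , rule x hole (q↑ _ _ _ _)
expand-above-instance x (p↓ R T) (!⁺ t a ⅋ ¿⁺ b) = _ , !⁺ t (a ⅋ b) , promotion↓ t _ _
expand-above-instance x (p↑ R T) (¿⁺ (a ⊗ b)) =
  _ , ¿⁺ a ⊗ !⁺ (!ˢ leaf) b , rule x hole (p↑ _ _)
expand-above-instance x (w↓ R) (¿⁺ a) = _ , ∘ , rule x hole (w↓ _)
expand-above-instance x (b↓ R) (¿⁺ a) = _ , ¿⁺ a ⅋ a , rule x hole (b↓ _)
expand-above-instance x (g↓ R) (¿⁺ a) = _ , ¿⁺ (¿⁺ a) , rule x hole (g↓ _)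
expand-above-instance () e↓ _
expand-above-instance () e↑ _
expand-above-instance () (w↑ R) _
expand-above-instance () (b↑ R) _
expand-above-instance () (g↑ R) _

expand-above-step : ∀ {pr cn} → Down r → (S : Ctx) → Inst r pr cn →
                    Expands ⁺ (plug S cn) C → ExpandThenDown (plug S pr) C
expand-above-step x hole i e = expand-above-instance x i e
expand-above-step x (⅋ˡ S T) i (a ⅋ b) =
  let _ , a′ , d = expand-above-step x S i a in _ , a′ ⅋ b , inContext (⅋ˡ hole _) d
expand-above-step x (⅋ʳ T S) i (b ⅋ a) =
  let _ , a′ , d = expand-above-step x S i a in _ , b ⅋ a′ , inContext (⅋ʳ _ hole) d
expand-above-step x (⊗ˡ S T) i (a ⊗ b) =
  let _ , a′ , d = expand-above-step x S i a in _ , a′ ⊗ b , inContext (⊗ˡ hole _) d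
expand-above-step x (⊗ʳ T S) i (b ⊗ a) =
  let _ , a′ , d = expand-above-step x S i a in _ , b ⊗ a′ , inContext (⊗ʳ _ hole) d
expand-above-step x (▷ˡ S T) i (a ▷ b) =
  let _ , a′ , d = expand-above-step x S i a in _ , a′ ▷ b , inContext (▷ˡ hole _) d
expand-above-step x (▷ʳ T S) i (b ▷ a) =
  let _ , a′ , d = expand-above-step x S i a in _ , b ▷ a′ , inContext (▷ʳ _ hole) d
expand-above-step x (¿c S) i (¿⁺ a) =
  let _ , a′ , d = expand-above-step x S i a in _ , ¿⁺ a′ , inContext (¿c hole) d
expand-above-step x (!c S) i (!⁺ t a) =
  let _ , a′ , d = expand-above-step x S i a in _ , !⁺ t a′ , shape!-map t d

expand-above-down : Deriv Down A B → Expands ⁺ B C → ExpandThenDown A C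
expand-above-down (done eq) e =
  let _ , e′ , eq′ = expands-resp-≈˘ eq e in _ , e′ , done eq′
expand-above-down ((x , step S pr cn i P≈ Q≈) ∷ d) e =
  let _ , e₁ , d₁ = expand-above-down d e
      _ , e₂ , eq₂ = expands-resp-≈ Q≈ e₁
      _ , e₃ , d₃ = expand-above-step x S i e₂
      _ , e₄ , eq₄ = expands-resp-≈˘ P≈ e₃
  in _ , e₄ , ≈-premise eq₄ (d₃ ++ ≈-premise (≈-sym eq₂) d₁)

up-instance-shape : ∀ {pr cn} → Up r → Inst r pr cn →
                    ∃[ t ] ∃[ R ] pr ≡ ! R × cn ≡ shape! t R
up-instance-shape w↑ (w↑ R) = unit , R , refl , refl
up-instance-shape b↑ (b↑ R) = !ˢ leaf ⊗ˢ leaf , R , refl , refl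
up-instance-shape g↑ (g↑ R) = !ˢ !ˢ leaf , R , refl , refl

up-step-expansion : Up r → Step r A B → ∃[ B′ ] Expands ⁺ A B′ × B′ ≈ B
up-step-expansion x (step S pr cn i P≈ Q≈) with up-instance-shape x i
... | t , R , refl , refl =
  let _ , e , eq = expands-resp-≈˘ P≈ (expands-in-context S (!⁺ t (expands-refl ⁺ R)))
  in _ , e , ≈-trans eq (≈-sym Q≈)

classify : SNEL′ r → Down r ⊎ Up r
classify ai↓ = inj₁ ai↓
classify ai↑ = inj₁ ai↑
classify s   = inj₁ s
classify q↓  = inj₁ q↓
classify q↑  = inj₁ q↑
classify p↓  = inj₁ p↓
classify p↑  = inj₁ p↑
classify w↓  = inj₁ w↓
classify b↓  = inj₁ b↓
classify g↓  = inj₁ g↓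
classify w↑  = inj₂ w↑
classify b↑  = inj₂ b↑
classify g↑  = inj₂ g↑

separate : Deriv Up A B → Deriv Down B C → Deriv SNEL′ C N →
           ∃[ A′ ] Deriv Up A A′ × Deriv Down A′ N
separate u d (done eq) = _ , u , ≈-conclusion d eq
separate u d ((x , st) ∷ rest) with classify x
... | inj₁ down = separate u (d ++ ((down , st) ∷ done ≈-refl)) rest
... | inj₂ up =
  let _ , e , eq = up-step-expansion up st
      _ , e′ , d′ = expand-above-down d e
  in separate (u ++ realize⁺ e′) (≈-conclusion d′ eq) rest

lemma5p14 : (P Q : Str) → Deriv SNEL′ P Q →
    Σ Str (λ P′ → Deriv UpGBW P P′ × Deriv SNEL′∖GBW P′ Q)
lemma5p14 P Q d = separate (done ≈-refl) (done ≈-refl) d
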